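{- Let $c$ be a positive integer and let $G$ be a triangle-free graph with $\chi(G)>2c+1$. Then there is an integer $r\geq 3$ and an $r$-leveling $(L_0,\ldots,L_r)$ in $G$ such that $\chi(G[L_r])=c+1$ and $G[L_r]$ is both non-degenerate and liberal.
   Context: Graphs are finite and simple. For $r\geq 0$, an $r$-leveling in $G$ is a tuple $(L_0,\ldots,L_r)$ of pairwise disjoint nonempty subsets of $V(G)$ such that (i) for each $i\in\{1,\ldots,r\}$ every vertex in $L_i$ has a neighbor in $L_{i-1}$, and (ii) for distinct $i,j$, if some edge has one end in $L_i$ and the other in $L_j$ then $|i-j|=1$. A graph $G$ is non-degenerate if every vertex has degree at least $\chi(G)-1$; liberal if for all distinct non-adjacent vertices $x,y$, both $N(x)\setminus N(y)$ and $N(y)\setminus N(x)$ are nonempty. -}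

module Defs where

open import Data.Nat using (ℕ; zero; suc; _≤_; _∸_)
open import Data.Bool using (Bool; true; false)
open import Data.Fin using (Fin; toℕ; inject₁; fromℕ)
open import Data.Fin.Subset using (Subset; _∈_; _∉_; _∩_; ∣_∣; Nonempty; ⊤)
open import Data.Vec using (tabulate)
open import Data.Product using (Σ; ∃; _×_; _,_)
open import Data.Sum using (_⊎_)
open import Relation.Nullary using (¬_)
open import Relation.Binary.PropositionalEquality using (_≡_; _≢_)

record Graph : Set where
  field
    n     : ℕ
    adj   : Fin n → Fin n → Bool
    sym   : ∀ u v → adj u v ≡ adj v u
    irrefl : ∀ v → adj v v ≡ false

open Graph public

Vtx : Graph → Set
Vtx G = Fin (n G)

VSet : Graph → Set
VSet G = Subset (n G)

Adj : (G : Graph) → Vtx G → Vtx G → Set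
Adj G u v = adj G u v ≡ true

TriangleFree : Graph → Set
TriangleFree G = ∀ u v w → Adj G u v → Adj G v w → Adj G u w → ⊥'
  where open import Data.Empty renaming (⊥ to ⊥')

ColorableOn : (G : Graph) → VSet G → ℕ → Set
ColorableOn G S k = Σ (Vtx G → Fin k) λ f →
  ∀ u v → u ∈ S → v ∈ S → Adj G u v → f u ≢ f v

ChromaticOn : (G : Graph) → VSet G → ℕ → Set
ChromaticOn G S k = ColorableOn G S k × (∀ j → ColorableOn G S j → k ≤ j)

nbhd : (G : Graph) → Vtx G → VSet G
nbhd G v = tabulate (adj G v)

degOn : (G : Graph) → VSet G → Vtx G → ℕ
degOn G S v = ∣ S ∩ nbhd G v ∣

NonDegenerateOn : (G : Graph) → VSet G → Set
NonDegenerateOn G S = ∀ k → ChromaticOn G S k → ∀ v → v ∈ S → k ∸ 1 ≤ degOn G S v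

LiberalOn : (G : Graph) → VSet G → Set
LiberalOn G S = ∀ x y → x ∈ S → y ∈ S → x ≢ y → adj G x y ≡ false →
  (∃ λ z → z ∈ S × Adj G x z × adj G y z ≡ false) ×
  (∃ λ z → z ∈ S × Adj G y z × adj G x z ≡ false)

IsLeveling : (G : Graph) (r : ℕ) → (Fin (suc r) → VSet G) → Set
IsLeveling G r L =
  (∀ i → Nonempty (L i)) ×
  (∀ i j → i ≢ j → ∀ v → v ∈ L i → v ∉ L j) ×
  (∀ (i : Fin r) v → v ∈ L (Data.Fin.suc i) → ∃ λ u → u ∈ L (inject₁ i) × Adj G v u) ×
  (∀ i j → i ≢ j → ∀ u v → u ∈ L i → v ∈ L j → Adj G u v →
     (toℕ i ≡ suc (toℕ j)) ⊎ (toℕ j ≡ suc (toℕ i)))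

-- Take S ⊆ V vertex-minimal with G[S] not (2c+1)-colorable, a vertex a ∈ S with a neighbor b ∈ S,
-- and the breadth-first spheres D₀ = {a}, D₁, D₂, … of G[S] around a; edges of G[S] only join
-- equal or consecutive spheres, and D₁ and D₂ ∩ N(b) are independent as G is triangle-free.
-- If D₂ ∖ N(b) or some Dᵣ with r ≥ 3 is not c-colorable, a vertex-minimal non-c-colorable T inside
-- it is (c+1)-chromatic, non-degenerate and liberal (in a c-coloring of T − x every color occurs
-- in N(x), or x could be colored), and ({b}, {a}, D₁ − b, T), resp. (D₀, …, Dᵣ₋₁, T), is the
-- required leveling. Otherwise give D₀ and D₂ ∩ N(b) one extra color, D₁ a color of a block H of
-- c colors, D₂ ∖ N(b) colors from a second block L, and D₃, D₄, … alternately colors from H and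
-- L; with a (2c+1)-coloring of S − a on the vertices not reachable from a, this (2c+1)-colors S,
-- a contradiction.

module Submission where

open import Defs
open import Level using (Level)
open import Data.Bool using (Bool; true; false; if_then_else_)
open import Data.Bool.Properties using (¬-not) renaming (_≟_ to _≟ᵇ_)
open import Data.Fin using (Fin; zero; suc; toℕ; fromℕ; fromℕ<; inject₁; inject≤; join; splitAt;
  finToFun; funToFin)
open import Data.Fin.Properties using (_≟_; any?; all?; suc-injective; 0≢1+n; toℕ<n; toℕ-injective;
  toℕ-fromℕ; toℕ-inject₁; inject₁-injective; inject≤-injective; fromℕ≢inject₁; splitAt-join;
  finToFun-funToFin; injective⇒≤)
open import Data.Fin.Subset using (Subset; inside; outside; _∈_; _∉_; _⊆_; _∩_; _∪_; _─_; _-_; ⁅_⁆;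
  ⊤; ∣_∣; Nonempty)
open import Data.Fin.Subset.Properties using (_∈?_; nonempty?; ⊆-refl; ⊆-trans; x∈⁅x⁆; x∈⁅y⁆⇒x≡y;
  x≢y⇒x∉⁅y⁆; x∉⁅y⁆⇒x≢y; x∈p∩q⁺; x∈p∩q⁻; x∈p∪q⁺; x∈p∪q⁻; p⊆p∪q; p─q⊆p; x∈p∧x∉q⇒x∈p─q;
  x∈p∧x≢y⇒x∈p-y; x∈p⇒∣p-x∣<∣p∣)
open import Data.Maybe using (Maybe; just; nothing)
import Data.Nat as ℕ
open import Data.Nat using (ℕ; zero; suc; _+_; _*_; _≤_; _<_; z≤n; s≤s; s≤s⁻¹; _≤′_; ≤′-refl;
  ≤′-step)
open import Data.Nat.Induction using (<-wellFounded)
open import Data.Nat.Properties using (≤-refl; ≤-trans; ≤-antisym; ≤-<-trans; <-irrefl; <-cmp;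
  ≤∧≢⇒<; ≰⇒>; ≮⇒≥; <⇒≱; ≤⇒≤′; m≤n⇒m≤1+n; m≤m+n; m≤n+m; +-identityʳ; ∸-monoˡ-≤; anyUpTo?)
open import Data.Product using (Σ; ∃; _×_; _,_; proj₁; proj₂; map₂)
open import Data.Sum using (_⊎_; inj₁; inj₂)
open import Data.Vec using (_∷_; tabulate; there)
open import Data.Vec.Properties using (lookup∘tabulate; lookup⇒[]=; []=⇒lookup)
open import Data.Vec.Functional using (updateAt)
open import Data.Vec.Functional.Properties using (updateAt-updates; updateAt-minimal)
open import Function using (_∘_; id; const)
open import Function.Definitions using (Injective)
open import Induction.WellFounded using (Acc; acc)
open import Relation.Binary using (tri<; tri≈; tri>)
open import Relation.Binary.PropositionalEquality as ≡ using (_≡_; _≢_; _≗_; refl; trans; cong; subst)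
open import Relation.Nullary using (¬_; Dec; yes; no; does; contradiction)
open import Relation.Nullary.Decidable using (_×-dec_; _→-dec_; ¬?; map′; dec-true; decidable-stable)
open import Relation.Unary using (Pred; Decidable)

private variable
  ℓ ℓ′ : Level
  A : Set ℓ
  B : Set ℓ′
  m k j : ℕ

∈-tabulate⁺ : ∀ {f : Fin m → Bool} {x} → f x ≡ true → x ∈ tabulate f
∈-tabulate⁺ {f = f} {x} fx = lookup⇒[]= x (tabulate f) (trans (lookup∘tabulate f x) fx)

∈-tabulate⁻ : ∀ {f : Fin m → Bool} {x} → x ∈ tabulate f → f x ≡ true
∈-tabulate⁻ {f = f} {x} x∈ = trans (≡.sym (lookup∘tabulate f x)) ([]=⇒lookup x∈)

x∈p─q⇒x∉q : ∀ (p q : Subset m) {x} → x ∈ p ─ q → x ∉ q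
x∈p─q⇒x∉q (_ ∷ p) (outside ∷ q) (there x∈) (there x∈q) = x∈p─q⇒x∉q p q x∈ x∈q
x∈p─q⇒x∉q (_ ∷ p) (inside ∷ q) (there x∈) (there x∈q) = x∈p─q⇒x∉q p q x∈ x∈q

x∈p-y⇒x≢y : ∀ (p : Subset m) {x y} → x ∈ p - y → x ≢ y
x∈p-y⇒x≢y p {y = y} x∈ = x∉⁅y⁆⇒x≢y (x∈p─q⇒x∉q p ⁅ y ⁆ x∈)

x∈p∪q∧x∉p⇒x∈q : ∀ (p q : Subset m) {x} → x ∈ p ∪ q → x ∉ p → x ∈ q
x∈p∪q∧x∉p⇒x∈q p q x∈ x∉p with x∈p∪q⁻ p q x∈
... | inj₁ x∈p = contradiction x∈p x∉p
... | inj₂ x∈q = x∈q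

p⊆q∪p─q : ∀ (p q : Subset m) → p ⊆ q ∪ (p ─ q)
p⊆q∪p─q p q {x} x∈p with x ∈? q
... | yes x∈q = x∈p∪q⁺ (inj₁ x∈q)
... | no x∉q = x∈p∪q⁺ (inj₂ (x∈p∧x∉q⇒x∈p─q x∈p x∉q))

injective⇒≤∣p∣ : ∀ {p : Subset m} (g : Fin k → Fin m) → Injective _≡_ _≡_ g → (∀ i → g i ∈ p) →
                 k ≤ ∣ p ∣
injective⇒≤∣p∣ {k = zero} _ _ _ = z≤n
injective⇒≤∣p∣ {k = suc k} g g-inj g∈p = ≤-<-trans
  (injective⇒≤∣p∣ (g ∘ suc) (suc-injective ∘ g-inj) λ i →
    x∈p∧x≢y⇒x∈p-y (g∈p (suc i)) (0≢1+n ∘ ≡.sym ∘ g-inj))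
  (x∈p⇒∣p-x∣<∣p∣ (g∈p zero))

⟦_⟧ : ∀ {P : Pred (Fin m) ℓ} → Decidable P → Subset m
⟦ P? ⟧ = tabulate (does ∘ P?)

∈⟦⟧⁺ : ∀ {P : Pred (Fin m) ℓ} {P? : Decidable P} {x} → P x → x ∈ ⟦ P? ⟧
∈⟦⟧⁺ {P? = P?} {x} px = ∈-tabulate⁺ (dec-true (P? x) px)

∈⟦⟧⁻ : ∀ {P : Pred (Fin m) ℓ} {P? : Decidable P} {x} → x ∈ ⟦ P? ⟧ → P x
∈⟦⟧⁻ {P? = P?} {x} x∈ with P? x | ∈-tabulate⁻ {f = does ∘ P?} x∈
... | yes px | _ = px

module Coloring (G : Graph) where

  Adj-sym : ∀ {u v} → Adj G u v → Adj G v u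
  Adj-sym {u} {v} uv = trans (sym G v u) uv

  Adj-irrefl : ∀ {u v} → Adj G u v → u ≢ v
  Adj-irrefl {u} uv refl with () ← trans (≡.sym uv) (irrefl G u)

  adj? : ∀ u v → Dec (Adj G u v)
  adj? u v = adj G u v ≟ᵇ true

  ∈-nbhd⁺ : ∀ {u v} → Adj G u v → v ∈ nbhd G u
  ∈-nbhd⁺ = ∈-tabulate⁺

  ∈-nbhd⁻ : ∀ {u v} → v ∈ nbhd G u → Adj G u v
  ∈-nbhd⁻ = ∈-tabulate⁻

  hasNbrIn? : ∀ X u → Dec (∃ λ w → w ∈ X × Adj G u w)
  hasNbrIn? X u = any? λ w → w ∈? X ×-dec adj? u w

  nbhdOf : VSet G → VSet G
  nbhdOf X = ⟦ hasNbrIn? X ⟧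

  ∈nbhdOf⁺ : ∀ {X u w} → w ∈ X → Adj G u w → u ∈ nbhdOf X
  ∈nbhdOf⁺ {X} w∈X uw = ∈⟦⟧⁺ {P? = hasNbrIn? X} (_ , w∈X , uw)

  ∈nbhdOf⁻ : ∀ {X u} → u ∈ nbhdOf X → ∃ λ w → w ∈ X × Adj G u w
  ∈nbhdOf⁻ {X} = ∈⟦⟧⁻ {P? = hasNbrIn? X}

  ProperOn : VSet G → (Vtx G → A) → Set _
  ProperOn S f = ∀ u v → u ∈ S → v ∈ S → Adj G u v → f u ≢ f v

  ProperOn-⊆ : ∀ {S T} {f : Vtx G → A} → T ⊆ S → ProperOn S f → ProperOn T f
  ProperOn-⊆ T⊆S f-proper u v u∈ v∈ = f-proper u v (T⊆S u∈) (T⊆S v∈)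

  ProperOn-∘ : ∀ {S} {f : Vtx G → A} {ι : A → B} → Injective _≡_ _≡_ ι → ProperOn S f →
               ProperOn S (ι ∘ f)
  ProperOn-∘ ι-inj f-proper u v u∈ v∈ uv = f-proper u v u∈ v∈ uv ∘ ι-inj

  ProperOn-≗ : ∀ {S} {f g : Vtx G → A} → f ≗ g → ProperOn S f → ProperOn S g
  ProperOn-≗ f≗g f-proper u v u∈ v∈ uv gu≡gv =
    f-proper u v u∈ v∈ uv (trans (f≗g u) (trans gu≡gv (≡.sym (f≗g v))))

  ProperOn-updateAt : ∀ {S v} {f : Vtx G → A} {i} → ProperOn (S - v) f →
                      (∀ {w} → w ∈ S → Adj G v w → f w ≢ i) → ProperOn S (updateAt f v (const i))
  ProperOn-updateAt {v = v} {f} {i} f-proper free x y x∈ y∈ xy with x ≟ v | y ≟ v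
  ... | yes refl | yes refl = contradiction refl (Adj-irrefl xy)
  ... | yes refl | no y≢v
    rewrite updateAt-updates x {const i} f | updateAt-minimal y x {const i} f y≢v =
    free y∈ xy ∘ ≡.sym
  ... | no x≢v | yes refl
    rewrite updateAt-updates y {const i} f | updateAt-minimal x y {const i} f x≢v =
    free x∈ (Adj-sym xy)
  ... | no x≢v | no y≢v
    rewrite updateAt-minimal x v {const i} f x≢v | updateAt-minimal y v {const i} f y≢v =
    f-proper x y (x∈p∧x≢y⇒x∈p-y x∈ x≢v) (x∈p∧x≢y⇒x∈p-y y∈ y≢v) xy

  proper? : ∀ S (f : Vtx G → Fin k) → Dec (ProperOn S f)
  proper? S f = all? λ u → all? λ v →
    u ∈? S →-dec v ∈? S →-dec adj? u v →-dec ¬? (f u ≟ f v)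

  colorable? : ∀ S k → Dec (ColorableOn G S k)
  colorable? S k = map′
    (λ (code , proper) → finToFun code , proper)
    (λ (f , f-proper) → funToFin f , ProperOn-≗ (≡.sym ∘ finToFun-funToFin f) f-proper)
    (any? (proper? S ∘ finToFun))

  colorable-⊆ : ∀ {S T} → T ⊆ S → ColorableOn G S k → ColorableOn G T k
  colorable-⊆ T⊆S (f , f-proper) = f , ProperOn-⊆ T⊆S f-proper

  colorable-≤ : ∀ {S} → k ≤ j → ColorableOn G S k → ColorableOn G S j
  colorable-≤ k≤j (f , f-proper) =
    (λ v → inject≤ (f v) k≤j) , ProperOn-∘ (inject≤-injective k≤j k≤j _ _) f-proper

  colorable-∪ : ∀ {X Y} → ColorableOn G X k → ColorableOn G Y k →
                (∀ {u v} → u ∈ X → v ∈ Y → ¬ Adj G u v) → ColorableOn G (X ∪ Y) k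
  colorable-∪ {X = X} {Y} (f , f-proper) (g , g-proper) no-edge = h , h-proper
    where
      h : Vtx G → Fin _
      h v = if does (v ∈? X) then f v else g v
      ∈Y : ∀ {v} → v ∈ X ∪ Y → v ∉ X → v ∈ Y
      ∈Y = x∈p∪q∧x∉p⇒x∈q X Y
      h-proper : ProperOn (X ∪ Y) h
      h-proper u v u∈ v∈ uv with u ∈? X | v ∈? X
      ... | yes u∈X | yes v∈X = f-proper u v u∈X v∈X uv
      ... | yes u∈X | no v∉X = λ _ → no-edge u∈X (∈Y v∈ v∉X) uv
      ... | no u∉X | yes v∈X = λ _ → no-edge v∈X (∈Y u∈ u∉X) (Adj-sym uv)
      ... | no u∉X | no v∉X = g-proper u v (∈Y u∈ u∉X) (∈Y v∈ v∉X) uv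

  ¬colorable⇒< : ∀ {S} → ¬ ColorableOn G S k → ColorableOn G S j → k < j
  ¬colorable⇒< ¬col col = ≰⇒> λ j≤k → ¬col (colorable-≤ j≤k col)

  chromatic-≤ : ∀ {S} m → ColorableOn G S m → ∃ λ k → k ≤ m × ChromaticOn G S k
  chromatic-≤ zero col = zero , z≤n , col , λ _ _ → z≤n
  chromatic-≤ {S = S} (suc m) col with colorable? S m
  ... | yes col′ = let k , k≤m , χ = chromatic-≤ m col′ in k , m≤n⇒m≤1+n k≤m , χ
  ... | no ¬col = suc m , ≤-refl , col , λ _ → ¬colorable⇒< ¬col

  ¬colorable-below-χ : ∀ {S} → (∀ k → ChromaticOn G S k → m < k) → ¬ ColorableOn G S m
  ¬colorable-below-χ {m} χ> col = let k , k≤m , χ = chromatic-≤ m col in <⇒≱ (χ> k χ) k≤m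

  record MinimalNonColorable (S : VSet G) (k : ℕ) : Set where
    field
      not-colorable   : ¬ ColorableOn G S k
      colorable-minus : ∀ {v} → v ∈ S → ColorableOn G (S - v) k

  minimalNonColorable-⊆ : ∀ {S k} → ¬ ColorableOn G S k →
                          ∃ λ T → T ⊆ S × MinimalNonColorable T k
  minimalNonColorable-⊆ {S} {k} = shrink S (<-wellFounded ∣ S ∣)
    where
      shrink : ∀ S → Acc _<_ ∣ S ∣ → ¬ ColorableOn G S k → ∃ λ T → T ⊆ S × MinimalNonColorable T k
      shrink S (acc smaller) ¬col with any? (λ v → v ∈? S ×-dec ¬? (colorable? (S - v) k))
      ... | yes (v , v∈S , ¬col-v) =
        let T , T⊆S-v , T-min = shrink (S - v) (smaller (x∈p⇒∣p-x∣<∣p∣ v∈S)) ¬col-v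
        in T , ⊆-trans T⊆S-v (p─q⊆p S ⁅ v ⁆) , T-min
      ... | no none = S , ⊆-refl , record
        { not-colorable = ¬col
        ; colorable-minus = λ {v} v∈S →
            decidable-stable (colorable? (S - v) k) λ ¬col-v → none (v , v∈S , ¬col-v)
        }

  nonempty : ∀ {S} → 0 < k → MinimalNonColorable S k → Nonempty S
  nonempty {k = suc _} {S} _ S-min with nonempty? S
  ... | yes ne = ne
  ... | no empty = contradiction ((λ _ → zero) , λ u _ u∈ _ _ _ → empty (u , u∈))
                                 (MinimalNonColorable.not-colorable S-min)

  module _ {S} (S-min : MinimalNonColorable S k) where
    open MinimalNonColorable S-min

    every-color-at-neighbor : ∀ {v} {f : Vtx G → Fin k} → v ∈ S → ProperOn (S - v) f →
                              ∀ i → ∃ λ w → w ∈ S × Adj G v w × f w ≡ i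
    every-color-at-neighbor {v} {f} v∈S f-proper i
      with any? (λ w → w ∈? S ×-dec adj? v w ×-dec f w ≟ i)
    ... | yes (w , w∈S , vw , fw≡i) = w , w∈S , vw , fw≡i
    ... | no none = contradiction
      (_ , ProperOn-updateAt f-proper λ w∈S vw fw≡i → none (_ , w∈S , vw , fw≡i))
      not-colorable

    colorable-suc : ∀ {v} → v ∈ S → ColorableOn G S (suc k)
    colorable-suc v∈S = let f , f-proper = colorable-minus v∈S in
      _ , ProperOn-updateAt (ProperOn-∘ inject₁-injective f-proper) λ _ _ → fromℕ≢inject₁ ∘ ≡.sym

    chromatic : ∀ {v} → v ∈ S → ChromaticOn G S (suc k)
    chromatic v∈S = colorable-suc v∈S , λ _ → ¬colorable⇒< not-colorable

    k≤deg : ∀ {v} → v ∈ S → k ≤ degOn G S v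
    k≤deg {v} v∈S with colorable-minus v∈S
    ... | f , f-proper = injective⇒≤∣p∣ w w-inj w∈
      where
        nbr = every-color-at-neighbor v∈S f-proper
        w : Fin k → Vtx G
        w i = proj₁ (nbr i)
        f∘w≗id : ∀ i → f (w i) ≡ i
        f∘w≗id i = let _ , _ , _ , fw≡i = nbr i in fw≡i
        w-inj : Injective _≡_ _≡_ w
        w-inj {i} {j} wi≡wj = trans (≡.sym (f∘w≗id i)) (trans (cong f wi≡wj) (f∘w≗id j))
        w∈ : ∀ i → w i ∈ S ∩ nbhd G v
        w∈ i = let _ , w∈S , vw , _ = nbr i in x∈p∩q⁺ (w∈S , ∈-nbhd⁺ vw)

    nonDegenerate : NonDegenerateOn G S
    nonDegenerate j (_ , j-min) v v∈S =
      ≤-trans (∸-monoˡ-≤ 1 (j-min _ (colorable-suc v∈S))) (k≤deg v∈S)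

    liberal : LiberalOn G S
    liberal x y x∈S y∈S x≢y _ =
      private-neighbor x∈S y∈S x≢y , private-neighbor y∈S x∈S (x≢y ∘ ≡.sym)
      where
        private-neighbor : ∀ {x y} → x ∈ S → y ∈ S → x ≢ y →
                           ∃ λ z → z ∈ S × Adj G x z × adj G y z ≡ false
        private-neighbor {x} {y} x∈S y∈S x≢y =
          let f , f-proper = colorable-minus x∈S
              z , z∈S , xz , fz≡fy = every-color-at-neighbor x∈S f-proper (f y)
              z∈S-x = x∈p∧x≢y⇒x∈p-y z∈S (Adj-irrefl xz ∘ ≡.sym)
              y∈S-x = x∈p∧x≢y⇒x∈p-y y∈S (x≢y ∘ ≡.sym)
          in z , z∈S , xz , ¬-not λ yz → f-proper z y z∈S-x y∈S-x (Adj-sym yz) fz≡fy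

module Levelings (G : Graph) where
  open Coloring G using (Adj-sym)

  -- An r-leveling indexed by ℕ; levels above r are ignored.
  record Leveling (r : ℕ) (L : ℕ → VSet G) : Set where
    field
      nonempty : ∀ {i} → i ≤ r → Nonempty (L i)
      disjoint : ∀ {i j v} → i < j → j ≤ r → v ∈ L i → v ∉ L j
      parent   : ∀ {i v} → i < r → v ∈ L (suc i) → ∃ λ u → u ∈ L i × Adj G v u
      no-skip  : ∀ {i j u v} → suc i < j → j ≤ r → u ∈ L i → v ∈ L j → ¬ Adj G u v

    adjacent-levels : ∀ {i j u v} → i < j → j ≤ r → u ∈ L i → v ∈ L j → Adj G u v → j ≡ suc i
    adjacent-levels i<j j≤r u∈ v∈ uv = ≤-antisym (≮⇒≥ λ i+1<j → no-skip i+1<j j≤r u∈ v∈ uv) i<j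

  Leveling⇒IsLeveling : ∀ {r L} → Leveling r L → IsLeveling G r (L ∘ toℕ)
  Leveling⇒IsLeveling {r} {L} lev = nonempty ∘ toℕ≤r , disjoint′ , parent′ , consecutive
    where
      open Leveling lev
      toℕ≤r : (i : Fin (suc r)) → toℕ i ≤ r
      toℕ≤r i = s≤s⁻¹ (toℕ<n i)
      disjoint′ : ∀ i j → i ≢ j → ∀ v → v ∈ L (toℕ i) → v ∉ L (toℕ j)
      disjoint′ i j i≢j v v∈i v∈j with <-cmp (toℕ i) (toℕ j)
      ... | tri< i<j _ _ = disjoint i<j (toℕ≤r j) v∈i v∈j
      ... | tri≈ _ i≡j _ = i≢j (toℕ-injective i≡j)
      ... | tri> _ _ j<i = disjoint j<i (toℕ≤r i) v∈j v∈i
      parent′ : ∀ (i : Fin r) v → v ∈ L (suc (toℕ i)) →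
                ∃ λ u → u ∈ L (toℕ (inject₁ i)) × Adj G v u
      parent′ i v v∈ = let u , u∈ , vu = parent (toℕ<n i) v∈ in
        u , subst (λ k → u ∈ L k) (≡.sym (toℕ-inject₁ i)) u∈ , vu
      consecutive : ∀ i j → i ≢ j → ∀ u v → u ∈ L (toℕ i) → v ∈ L (toℕ j) → Adj G u v →
                    toℕ i ≡ suc (toℕ j) ⊎ toℕ j ≡ suc (toℕ i)
      consecutive i j i≢j u v u∈ v∈ uv with <-cmp (toℕ i) (toℕ j)
      ... | tri< i<j _ _ = inj₂ (adjacent-levels i<j (toℕ≤r j) u∈ v∈ uv)
      ... | tri≈ _ i≡j _ = contradiction (toℕ-injective i≡j) i≢j
      ... | tri> _ _ j<i = inj₁ (adjacent-levels j<i (toℕ≤r i) v∈ u∈ (Adj-sym uv))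

  _[_]≔_ : (ℕ → VSet G) → ℕ → VSet G → ℕ → VSet G
  (L [ r ]≔ T) i with i ℕ.≟ r
  ... | yes _ = T
  ... | no _ = L i

  []≔-updates : ∀ L r T → (L [ r ]≔ T) r ≡ T
  []≔-updates L r T with r ℕ.≟ r
  ... | yes _ = refl
  ... | no r≢r = contradiction refl r≢r

  []≔-⊆ : ∀ {L r T} → T ⊆ L r → ∀ i → (L [ r ]≔ T) i ⊆ L i
  []≔-⊆ {r = r} T⊆ i with i ℕ.≟ r
  ... | yes refl = T⊆
  ... | no _ = id

  shrink-top : ∀ {r L T} → Leveling r L → T ⊆ L r → Nonempty T → Leveling r (L [ r ]≔ T)
  shrink-top {r} {L} {T} lev T⊆ T-nonempty = record
    { nonempty = nonempty′
    ; disjoint = λ i<j j≤r u∈ v∈ → disjoint i<j j≤r (shrunk⊆ _ u∈) (shrunk⊆ _ v∈)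
    ; parent = parent′
    ; no-skip = λ i+1<j j≤r u∈ v∈ → no-skip i+1<j j≤r (shrunk⊆ _ u∈) (shrunk⊆ _ v∈)
    }
    where
      open Leveling lev
      shrunk⊆ = []≔-⊆ {L} {r} {T} T⊆
      nonempty′ : ∀ {i} → i ≤ r → Nonempty ((L [ r ]≔ T) i)
      nonempty′ {i} i≤r with i ℕ.≟ r
      ... | yes _ = T-nonempty
      ... | no _ = nonempty i≤r
      parent′ : ∀ {i v} → i < r → v ∈ (L [ r ]≔ T) (suc i) → ∃ λ u → u ∈ (L [ r ]≔ T) i × Adj G v u
      parent′ {i} i<r v∈ with i ℕ.≟ r | parent i<r (shrunk⊆ (suc i) v∈)
      ... | yes refl | _ = contradiction i<r (<-irrefl refl)
      ... | no _ | found = found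

module Spheres (G : Graph) (S : VSet G) {a : Vtx G} (a∈S : a ∈ S) where
  open Coloring G
  open Levelings G

  ball : ℕ → VSet G
  ball zero = ⁅ a ⁆
  ball (suc m) = ball m ∪ (S ∩ nbhdOf (ball m))

  sphere : ℕ → VSet G
  sphere zero = ball zero
  sphere (suc m) = ball (suc m) ─ ball m

  ball⊆S : ∀ m → ball m ⊆ S
  ball⊆S zero v∈ rewrite x∈⁅y⁆⇒x≡y a v∈ = a∈S
  ball⊆S (suc m) v∈ with x∈p∪q⁻ (ball m) _ v∈
  ... | inj₁ v∈ball = ball⊆S m v∈ball
  ... | inj₂ v∈S∩ = proj₁ (x∈p∩q⁻ S _ v∈S∩)

  ball-step : ∀ m {u w} → w ∈ ball m → u ∈ S → Adj G u w → u ∈ ball (suc m)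
  ball-step _ w∈ u∈S uw = x∈p∪q⁺ (inj₂ (x∈p∩q⁺ (u∈S , ∈nbhdOf⁺ w∈ uw)))

  ball-mono : ∀ {m k} → m ≤ k → ball m ⊆ ball k
  ball-mono = mono′ ∘ ≤⇒≤′
    where
      mono′ : ∀ {m k} → m ≤′ k → ball m ⊆ ball k
      mono′ ≤′-refl = id
      mono′ (≤′-step m≤′k) = p⊆p∪q _ ∘ mono′ m≤′k

  sphere⊆ball : ∀ i → sphere i ⊆ ball i
  sphere⊆ball zero = id
  sphere⊆ball (suc i) = p─q⊆p (ball (suc i)) (ball i)

  sphere⊆S : ∀ i → sphere i ⊆ S
  sphere⊆S i = ball⊆S i ∘ sphere⊆ball i

  ∈sphere⇒∉ball : ∀ i {v} → v ∈ sphere (suc i) → v ∉ ball i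
  ∈sphere⇒∉ball i = x∈p─q⇒x∉q (ball (suc i)) (ball i)

  ∈ball⇒∈sphere : ∀ m {v} → v ∈ ball m → ∃ λ i → v ∈ sphere i
  ∈ball⇒∈sphere zero v∈ = zero , v∈
  ∈ball⇒∈sphere (suc m) {v} v∈ with v ∈? ball m
  ... | yes v∈m = ∈ball⇒∈sphere m v∈m
  ... | no v∉m = suc m , x∈p∧x∉q⇒x∈p─q v∈ v∉m

  sphere-disjoint : ∀ {i j v} → i < j → v ∈ sphere i → v ∉ sphere j
  sphere-disjoint {i} {suc j} (s≤s i≤j) v∈i v∈j =
    ∈sphere⇒∉ball j v∈j (ball-mono i≤j (sphere⊆ball i v∈i))

  sphere-no-skip : ∀ {i j u v} → suc i < j → u ∈ sphere i → v ∈ sphere j → ¬ Adj G u v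
  sphere-no-skip {i} {suc j} (s≤s i<j) u∈ v∈ uv = ∈sphere⇒∉ball j v∈
    (ball-mono i<j (ball-step i (sphere⊆ball i u∈) (sphere⊆S (suc j) v∈) (Adj-sym uv)))

  ∈sphere⇒nbr∈ball : ∀ i {v} → v ∈ sphere (suc i) → ∃ λ w → w ∈ ball i × Adj G v w
  ∈sphere⇒nbr∈ball i v∈ = ∈nbhdOf⁻ (proj₂ (x∈p∩q⁻ S _
    (x∈p∪q∧x∉p⇒x∈q (ball i) _ (sphere⊆ball (suc i) v∈) (∈sphere⇒∉ball i v∈))))

  sphere-parent : ∀ i {v} → v ∈ sphere (suc i) → ∃ λ u → u ∈ sphere i × Adj G v u
  sphere-parent zero = ∈sphere⇒nbr∈ball zero
  sphere-parent (suc i) v∈ with ∈sphere⇒nbr∈ball (suc i) v∈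
  ... | w , w∈ , vw with w ∈? ball i
  ...   | yes w∈i = contradiction (ball-step i w∈i (sphere⊆S (suc (suc i)) v∈) vw)
                                  (∈sphere⇒∉ball (suc i) v∈)
  ...   | no w∉i = w , x∈p∧x∉q⇒x∈p─q w∈ w∉i , vw

  sphere-nonempty-below : ∀ i {v} → v ∈ sphere i → ∀ {j} → j ≤ i → Nonempty (sphere j)
  sphere-nonempty-below zero v∈ z≤n = _ , v∈
  sphere-nonempty-below (suc i) v∈ {j} j≤ with j ℕ.≟ suc i
  ... | yes refl = _ , v∈
  ... | no j≢ = let u , u∈ , _ = sphere-parent i v∈ in
    sphere-nonempty-below i u∈ (s≤s⁻¹ (≤∧≢⇒< j≤ j≢))

  sphere-bounded : ∀ i {v} → v ∈ sphere i → i < n G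
  sphere-bounded i v∈ = injective⇒≤ pick-inj
    where
      pick : Fin (suc i) → Vtx G
      pick j = proj₁ (sphere-nonempty-below i v∈ (s≤s⁻¹ (toℕ<n j)))
      pick∈ : ∀ j → pick j ∈ sphere (toℕ j)
      pick∈ j = proj₂ (sphere-nonempty-below i v∈ (s≤s⁻¹ (toℕ<n j)))
      pick-inj : Injective _≡_ _≡_ pick
      pick-inj {j} {k} eq with <-cmp (toℕ j) (toℕ k)
      ... | tri< j<k _ _ =
        contradiction (subst (_∈ sphere (toℕ k)) (≡.sym eq) (pick∈ k)) (sphere-disjoint j<k (pick∈ j))
      ... | tri≈ _ j≡k _ = toℕ-injective j≡k
      ... | tri> _ _ k<j =
        contradiction (subst (_∈ sphere (toℕ j)) eq (pick∈ j)) (sphere-disjoint k<j (pick∈ k))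

  ball-closed : ∀ {u v} → u ∈ ball (n G) → v ∈ S → Adj G v u → v ∈ ball (n G)
  ball-closed u∈ v∈S vu = let i , u∈i = ∈ball⇒∈sphere (n G) u∈ in
    ball-mono (sphere-bounded i u∈i) (ball-step i (sphere⊆ball i u∈i) v∈S vu)

  spheres-leveling : ∀ r → Nonempty (sphere r) → Leveling r sphere
  spheres-leveling r (_ , v∈) = record
    { nonempty = sphere-nonempty-below r v∈
    ; disjoint = λ i<j _ → sphere-disjoint i<j
    ; parent = λ {i} _ → sphere-parent i
    ; no-skip = λ i+1<j _ → sphere-no-skip i+1<j
    }

  sphere-adjacent : ∀ {i j u v} → i < j → u ∈ sphere i → v ∈ sphere j → Adj G u v → j ≡ suc i
  sphere-adjacent {j = j} i<j u∈ v∈ =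
    Leveling.adjacent-levels (spheres-leveling j (_ , v∈)) i<j ≤-refl u∈ v∈

  -- The value 0 off ball (n G) is junk.
  depth : Vtx G → ℕ
  depth v with v ∈? ball (n G)
  ... | yes v∈ = proj₁ (∈ball⇒∈sphere (n G) v∈)
  ... | no _ = 0

  ∈sphere-depth : ∀ {v} → v ∈ ball (n G) → v ∈ sphere (depth v)
  ∈sphere-depth {v} v∈ with v ∈? ball (n G)
  ... | yes v∈′ = proj₂ (∈ball⇒∈sphere (n G) v∈′)
  ... | no v∉ = contradiction v∈ v∉

Palette : ℕ → Set
Palette c = Maybe (Fin c ⊎ Fin c)

pattern top = nothing
pattern low i = just (inj₁ i)
pattern high i = just (inj₂ i)

encode : ∀ {c} → Palette c → Fin (suc (c + c))
encode top = zero
encode {c} (just x) = suc (join c c x)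

encode-injective : ∀ {c} → Injective _≡_ _≡_ (encode {c})
encode-injective {x = top} {top} _ = refl
encode-injective {c} {just x} {just y} eq = cong just (begin
  x                       ≡⟨ splitAt-join c c x ⟨
  splitAt c (join c c x)  ≡⟨ cong (splitAt c) (suc-injective eq) ⟩
  splitAt c (join c c y)  ≡⟨ splitAt-join c c y ⟩
  y                       ∎)
  where open ≡.≡-Reasoning

low-injective : ∀ {c} {x y : Fin c} → _≡_ {A = Palette c} (low x) (low y) → x ≡ y
low-injective refl = refl

alternate : ∀ {c} → ℕ → Fin c → Palette c
alternate zero = high
alternate (suc zero) = low
alternate (suc (suc i)) = alternate i

alternate-injective : ∀ {c} i {x y : Fin c} → alternate i x ≡ alternate i y → x ≡ y
alternate-injective zero refl = refl
alternate-injective (suc zero) refl = refl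
alternate-injective (suc (suc i)) = alternate-injective i

alternate-≢-suc : ∀ {c} i {x y : Fin c} → alternate i x ≢ alternate (suc i) y
alternate-≢-suc zero ()
alternate-≢-suc (suc zero) ()
alternate-≢-suc (suc (suc i)) = alternate-≢-suc i

module AroundEdge (G : Graph) (tf : TriangleFree G) {S : VSet G} {a b : Vtx G}
                  (a∈S : a ∈ S) (b∈S : b ∈ S) (ab : Adj G a b) where
  open Coloring G
  open Levelings G
  open Spheres G S a∈S

  sphere₂∖Nb : VSet G
  sphere₂∖Nb = sphere 2 ─ nbhd G b

  b∈sphere₁ : b ∈ sphere 1
  b∈sphere₁ = x∈p∧x∉q⇒x∈p─q (ball-step 0 (x∈⁅x⁆ a) b∈S (Adj-sym ab))
                            (x≢y⇒x∉⁅y⁆ (Adj-irrefl ab ∘ ≡.sym))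

  sphere₁-adj-a : ∀ {v} → v ∈ sphere 1 → Adj G v a
  sphere₁-adj-a v∈ with sphere-parent 0 v∈
  ... | u , u∈ , vu with refl ← x∈⁅y⁆⇒x≡y a u∈ = vu

  rooted-at-b : VSet G → ℕ → VSet G
  rooted-at-b T 0 = ⁅ b ⁆
  rooted-at-b T 1 = ⁅ a ⁆
  rooted-at-b T 2 = sphere 1 - b
  rooted-at-b T (suc (suc (suc _))) = T

  module _ {T} (T⊆ : T ⊆ sphere₂∖Nb) where

    private
      T⊆sphere₂ : T ⊆ sphere 2
      T⊆sphere₂ = p─q⊆p (sphere 2) (nbhd G b) ∘ T⊆

      ¬Adj-b : ∀ {v} → v ∈ T → ¬ Adj G b v
      ¬Adj-b v∈ = x∈p─q⇒x∉q (sphere 2) (nbhd G b) (T⊆ v∈) ∘ ∈-nbhd⁺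

      sphere₁-b⊆sphere₁ : sphere 1 - b ⊆ sphere 1
      sphere₁-b⊆sphere₁ = p─q⊆p (sphere 1) ⁅ b ⁆

    rooted-at-b-parent : ∀ {i v} → i < 3 → v ∈ rooted-at-b T (suc i) →
                         ∃ λ u → u ∈ rooted-at-b T i × Adj G v u
    rooted-at-b-parent {0} _ v∈ with refl ← x∈⁅y⁆⇒x≡y a v∈ = b , x∈⁅x⁆ b , ab
    rooted-at-b-parent {1} _ v∈ = a , x∈⁅x⁆ a , sphere₁-adj-a (sphere₁-b⊆sphere₁ v∈)
    rooted-at-b-parent {2} _ v∈ = let u , u∈ , vu = sphere-parent 1 (T⊆sphere₂ v∈) in
      u , x∈p∧x≢y⇒x∈p-y u∈ (λ u≡b → ¬Adj-b v∈ (Adj-sym (subst (Adj G _) u≡b vu))) , vu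
    rooted-at-b-parent {suc (suc (suc _))} (s≤s (s≤s (s≤s ()))) _

    rooted-at-b-disjoint : ∀ {i j v} → i < j → j ≤ 3 → v ∈ rooted-at-b T i → v ∉ rooted-at-b T j
    rooted-at-b-disjoint {0} {1} _ _ v∈ v∈′ with refl ← x∈⁅y⁆⇒x≡y b v∈ =
      Adj-irrefl ab (≡.sym (x∈⁅y⁆⇒x≡y a v∈′))
    rooted-at-b-disjoint {0} {2} _ _ v∈ v∈′ with refl ← x∈⁅y⁆⇒x≡y b v∈ =
      x∈p-y⇒x≢y (sphere 1) v∈′ refl
    rooted-at-b-disjoint {0} {3} _ _ v∈ v∈′ with refl ← x∈⁅y⁆⇒x≡y b v∈ =
      sphere-disjoint {1} {2} ≤-refl b∈sphere₁ (T⊆sphere₂ v∈′)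
    rooted-at-b-disjoint {1} {2} _ _ v∈ v∈′ =
      sphere-disjoint {0} {1} ≤-refl v∈ (sphere₁-b⊆sphere₁ v∈′)
    rooted-at-b-disjoint {1} {3} _ _ v∈ v∈′ =
      sphere-disjoint {0} {2} (s≤s z≤n) v∈ (T⊆sphere₂ v∈′)
    rooted-at-b-disjoint {2} {3} _ _ v∈ v∈′ =
      sphere-disjoint {1} {2} ≤-refl (sphere₁-b⊆sphere₁ v∈) (T⊆sphere₂ v∈′)
    rooted-at-b-disjoint {j = suc (suc (suc (suc _)))} _ (s≤s (s≤s (s≤s ())))
    rooted-at-b-disjoint {1} {1} (s≤s ()) _
    rooted-at-b-disjoint {suc (suc _)} {1} (s≤s ()) _
    rooted-at-b-disjoint {suc (suc _)} {2} (s≤s (s≤s ())) _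
    rooted-at-b-disjoint {suc (suc (suc _))} {3} (s≤s (s≤s (s≤s ()))) _

    rooted-at-b-no-skip : ∀ {i j u v} → suc i < j → j ≤ 3 →
                          u ∈ rooted-at-b T i → v ∈ rooted-at-b T j → ¬ Adj G u v
    rooted-at-b-no-skip {0} {2} _ _ u∈ v∈ uv with refl ← x∈⁅y⁆⇒x≡y b u∈ =
      tf a b _ ab uv (Adj-sym (sphere₁-adj-a (sphere₁-b⊆sphere₁ v∈)))
    rooted-at-b-no-skip {0} {3} _ _ u∈ v∈ uv with refl ← x∈⁅y⁆⇒x≡y b u∈ = ¬Adj-b v∈ uv
    rooted-at-b-no-skip {1} {3} _ _ u∈ v∈ = sphere-no-skip {0} {2} ≤-refl u∈ (T⊆sphere₂ v∈)
    rooted-at-b-no-skip {j = suc (suc (suc (suc _)))} _ (s≤s (s≤s (s≤s ())))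
    rooted-at-b-no-skip {0} {1} (s≤s ()) _
    rooted-at-b-no-skip {suc _} {1} (s≤s ()) _
    rooted-at-b-no-skip {suc _} {2} (s≤s (s≤s ())) _
    rooted-at-b-no-skip {suc (suc _)} {3} (s≤s (s≤s (s≤s ()))) _

    rooted-at-b-leveling : Nonempty T → Leveling 3 (rooted-at-b T)
    rooted-at-b-leveling (t , t∈T) = record
      { nonempty = nonempty′
      ; disjoint = rooted-at-b-disjoint
      ; parent = rooted-at-b-parent
      ; no-skip = rooted-at-b-no-skip
      }
      where
        nonempty′ : ∀ {i} → i ≤ 3 → Nonempty (rooted-at-b T i)
        nonempty′ {0} _ = b , x∈⁅x⁆ b
        nonempty′ {1} _ = a , x∈⁅x⁆ a
        nonempty′ {2} _ = let u , u∈ , _ = rooted-at-b-parent {2} ≤-refl t∈T in u , u∈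
        nonempty′ {3} _ = t , t∈T
        nonempty′ {suc (suc (suc (suc _)))} (s≤s (s≤s (s≤s ())))

  module Painting {c} (h₀ : Fin c) {f₂ : Vtx G → Fin c} (f₂-proper : ProperOn sphere₂∖Nb f₂)
                  (F : ℕ → Vtx G → Fin c) (F-proper : ∀ i → ProperOn (sphere (3 + i)) (F i)) where

    paint : ℕ → Vtx G → Palette c
    paint 0 _ = top
    paint 1 _ = high h₀
    paint 2 v = if does (v ∈? nbhd G b) then top else low (f₂ v)
    paint (suc (suc (suc i))) v = alternate i (F i v)

    paint-within : ∀ i {u v} → u ∈ sphere i → v ∈ sphere i → Adj G u v → paint i u ≢ paint i v
    paint-within 0 u∈ v∈ uv with refl ← x∈⁅y⁆⇒x≡y a u∈ | refl ← x∈⁅y⁆⇒x≡y a v∈ =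
      λ _ → Adj-irrefl uv refl
    paint-within 1 u∈ v∈ uv _ =
      tf a _ _ (Adj-sym (sphere₁-adj-a u∈)) uv (Adj-sym (sphere₁-adj-a v∈))
    paint-within 2 {u} {v} u∈ v∈ uv with u ∈? nbhd G b | v ∈? nbhd G b
    ... | yes bu | yes bv = λ _ → tf b u v (∈-nbhd⁻ bu) uv (∈-nbhd⁻ bv)
    ... | yes _ | no _ = λ ()
    ... | no _ | yes _ = λ ()
    ... | no bu | no bv =
      f₂-proper u v (x∈p∧x∉q⇒x∈p─q u∈ bu) (x∈p∧x∉q⇒x∈p─q v∈ bv) uv ∘ low-injective {c}
    paint-within (suc (suc (suc i))) u∈ v∈ uv = F-proper i _ _ u∈ v∈ uv ∘ alternate-injective i

    paint-across : ∀ i {u v} → paint i u ≢ paint (suc i) v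
    paint-across 0 ()
    paint-across 1 {v = v} with v ∈? nbhd G b
    ... | yes _ = λ ()
    ... | no _ = λ ()
    paint-across 2 {u} with u ∈? nbhd G b
    ... | yes _ = λ ()
    ... | no _ = λ ()
    paint-across (suc (suc (suc i))) = alternate-≢-suc i

    paint-proper : ∀ i j {u v} → u ∈ sphere i → v ∈ sphere j → Adj G u v → paint i u ≢ paint j v
    paint-proper i j u∈ v∈ uv with <-cmp i j
    ... | tri< i<j _ _ with refl ← sphere-adjacent i<j u∈ v∈ uv = paint-across i
    ... | tri≈ _ refl _ = paint-within i u∈ v∈ uv
    ... | tri> _ _ j<i with refl ← sphere-adjacent j<i v∈ u∈ (Adj-sym uv) = paint-across j ∘ ≡.sym

    ball-colorable : ColorableOn G (ball (n G)) (suc (c + c))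
    ball-colorable = encode ∘ (λ v → paint (depth v) v) , ProperOn-∘ {ι = encode} encode-injective
      λ u v u∈ v∈ → paint-proper (depth u) (depth v) (∈sphere-depth u∈) (∈sphere-depth v∈)

  S-colorable : ∀ {c} → 0 < c → ColorableOn G sphere₂∖Nb c →
                (∀ i → ColorableOn G (sphere (3 + i)) c) →
                ColorableOn G (S - a) (suc (c + c)) → ColorableOn G S (suc (c + c))
  S-colorable 0<c (_ , f₂-proper) sphere-colorable S-a-colorable =
    colorable-⊆ (p⊆q∪p─q S (ball (n G)))
      (colorable-∪ ball-colorable (colorable-⊆ unreached⊆S-a S-a-colorable) no-edge)
    where
      open Painting (fromℕ< 0<c) f₂-proper (proj₁ ∘ sphere-colorable) (proj₂ ∘ sphere-colorable)
      a∈ball : a ∈ ball (n G)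
      a∈ball = ball-mono {0} {n G} z≤n (x∈⁅x⁆ a)
      unreached⊆S-a : S ─ ball (n G) ⊆ S - a
      unreached⊆S-a v∈ = x∈p∧x≢y⇒x∈p-y (p─q⊆p S _ v∈) λ { refl → x∈p─q⇒x∉q S _ v∈ a∈ball }
      no-edge : ∀ {u v} → u ∈ ball (n G) → v ∈ S ─ ball (n G) → ¬ Adj G u v
      no-edge u∈ v∈ uv = x∈p─q⇒x∉q S _ v∈ (ball-closed u∈ (p─q⊆p S _ v∈) (Adj-sym uv))

  leveling-with-critical-top : ∀ {c} → 0 < c → MinimalNonColorable S (suc (c + c)) →
                               ∃ λ r → 3 ≤ r × ∃ λ L → Leveling r L × MinimalNonColorable (L r) c
  leveling-with-critical-top {c} 0<c S-min
    with colorable? sphere₂∖Nb c | anyUpTo? (λ i → ¬? (colorable? (sphere (3 + i)) c)) (n G)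
  ... | no ¬col | _ =
    let T , T⊆ , T-min = minimalNonColorable-⊆ ¬col in
    3 , ≤-refl , rooted-at-b T , rooted-at-b-leveling T⊆ (nonempty 0<c T-min) , T-min
  ... | yes _ | yes (i , _ , ¬col) =
    let T , T⊆ , T-min = minimalNonColorable-⊆ ¬col
        T-nonempty = nonempty 0<c T-min
    in 3 + i , m≤m+n 3 i , sphere [ 3 + i ]≔ T ,
       shrink-top (spheres-leveling (3 + i) (map₂ T⊆ T-nonempty)) T⊆ T-nonempty ,
       subst (λ X → MinimalNonColorable X c) (≡.sym ([]≔-updates sphere (3 + i) T)) T-min
  ... | yes col₂ | no none = contradiction
    (S-colorable 0<c col₂ sphere-colorable (MinimalNonColorable.colorable-minus S-min a∈S))
    (MinimalNonColorable.not-colorable S-min)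
    where
      sphere-colorable : ∀ i → ColorableOn G (sphere (3 + i)) c
      sphere-colorable i with i ℕ.<? n G
      ... | yes i<n = decidable-stable (colorable? _ c) λ ¬col → none (i , i<n , ¬col)
      ... | no i≮n = (λ _ → fromℕ< 0<c) , λ u _ u∈ _ _ _ →
        i≮n (≤-trans (s≤s (m≤n+m i 3)) (sphere-bounded (3 + i) u∈))

lemma2p3 : (c : ℕ) → 1 ≤ c → (G : Graph) → TriangleFree G →
    (∀ k → ChromaticOn G ⊤ k → suc (2 * c) < k) →
    Σ ℕ λ r → 3 ≤ r × Σ (Fin (suc r) → VSet G) λ L → IsLeveling G r L ×
      ChromaticOn G (L (fromℕ r)) (suc c) × NonDegenerateOn G (L (fromℕ r)) × LiberalOn G (L (fromℕ r))
lemma2p3 c 0<c G tf χ>2c+1 =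
  let _ , _ , S-min = minimalNonColorable-⊆ ¬colorable
      a , a∈S = nonempty (s≤s z≤n) S-min
      _ , f-proper = MinimalNonColorable.colorable-minus S-min a∈S
      b , b∈S , ab , _ = every-color-at-neighbor S-min a∈S f-proper zero
      r , 3≤r , L , L-leveling , T-min =
        AroundEdge.leveling-with-critical-top G tf a∈S b∈S ab 0<c S-min
      T-min′ = subst (λ i → MinimalNonColorable (L i) c) (≡.sym (toℕ-fromℕ r)) T-min
  in r , 3≤r , L ∘ toℕ , Leveling⇒IsLeveling L-leveling ,
     chromatic T-min′ (proj₂ (nonempty 0<c T-min′)) , nonDegenerate T-min′ , liberal T-min′
  where
    open Coloring G
    open Levelings G
    ¬colorable : ¬ ColorableOn G ⊤ (suc (c + c))
    ¬colorable = subst (λ k → ¬ ColorableOn G ⊤ (suc (c + k))) (+-identityʳ c)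
                       (¬colorable-below-χ χ>2c+1)
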